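{- Let $(a_n^k)_{n\ge 0,\,k\ge 0}$ be an array of real numbers satisfying $$a_n^k=a_{n-1}^k+a_n^{k-1}\qquad (n\ge 1,\ k\ge 1).$$ Define the formal power series ${}^0a(t)=\sum_{n=1}^{\infty}a_n^0t^n$ and ${}^0\overline{a(t)}=\sum_{k=1}^{\infty}a_0^kt^k$. Then for every integer $k\ge 1$, $${}^k a(t):=\sum_{n=1}^{\infty}a_n^k t^n=\frac{1}{(1-t)^k}\left\{{}^0a(t)+\frac{t}{1-t}\sum_{r=1}^{k}a_0^r(1-t)^r\right\},$$ and for every integer $n\ge 1$, $${}^n\overline{a(t)}:=\sum_{k=1}^{\infty}a_n^k t^k=\frac{1}{(1-t)^n}\left\{{}^0\overline{a(t)}+\frac{t}{1-t}\sum_{j=1}^{n}a_j^0(1-t)^j\right\},$$ as identities of formal power series in $t$.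
   Context: The array is determined by the two initial sequences $a_n^0$ (first row, $n\ge 0$) and $a_0^k$ (first column, $k\ge 0$); $k$ indexes rows and $n$ indexes columns. -}

module Defs where

open import Level using (Level)
open import Data.Nat using (ℕ; zero; suc; _∸_)
open import Algebra.Bundles using (CommutativeRing)

module FPS {c ℓ : Level} (R : CommutativeRing c ℓ) where
  open CommutativeRing R hiding (zero)

  Series : Set c
  Series = ℕ → Carrier

  _≈ₛ_ : Series → Series → Set ℓ
  f ≈ₛ g = ∀ n → f n ≈ g n
  infix 4 _≈ₛ_

  sumUpTo : ℕ → (ℕ → Carrier) → Carrier
  sumUpTo zero    h = h zero
  sumUpTo (suc n) h = sumUpTo n h + h (suc n)

  _+ₛ_ : Series → Series → Series
  (f +ₛ g) n = f n + g n
  infixl 6 _+ₛ_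

  _-ₛ_ : Series → Series → Series
  (f -ₛ g) n = f n - g n
  infixl 6 _-ₛ_

  _*ₛ_ : Series → Series → Series
  (f *ₛ g) n = sumUpTo n (λ i → f i * g (n ∸ i))
  infixl 7 _*ₛ_

  const : Carrier → Series
  const x zero    = x
  const x (suc n) = 0#

  zeroₛ oneₛ : Series
  zeroₛ = const 0#
  oneₛ  = const 1#

  tₛ : Series
  tₛ zero          = 0#
  tₛ (suc zero)    = 1#
  tₛ (suc (suc n)) = 0#

  _^ₛ_ : Series → ℕ → Series
  f ^ₛ zero  = oneₛ
  f ^ₛ suc k = f *ₛ (f ^ₛ k)

  oneMinusT : Series
  oneMinusT = oneₛ -ₛ tₛ

  -- 1/(1-t) as a formal power series: the geometric series 1 + t + t^2 + ...
  -- (the multiplicative inverse of 1 - t in R[[t]])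
  inv1-t : Series
  inv1-t n = 1#

  sumFrom1 : ℕ → (ℕ → Series) → Series
  sumFrom1 zero    F = zeroₛ
  sumFrom1 (suc k) F = sumFrom1 k F +ₛ F (suc k)

  -- Array a n k : n indexes columns, k indexes rows.
  Array : Set c
  Array = ℕ → ℕ → Carrier

  rowSeries : Array → ℕ → Series
  rowSeries a k zero    = 0#
  rowSeries a k (suc n) = a (suc n) k

  colSeries : Array → ℕ → Series
  colSeries a n zero    = 0#
  colSeries a n (suc k) = a n (suc k)

{-# OPTIONS --safe #-}
module Submission where

-- Pascal's rule telescopes to aₙᵏ⁺¹ = a₀ᵏ⁺¹ + Σⱼ₌₁ⁿ aⱼᵏ, and multiplying by 1/(1-t) takes
-- partial sums, so (1-t)·ᵏ⁺¹a = ᵏa + a₀ᵏ⁺¹ t. Induction on k then gives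
-- (1-t)ᵏ·ᵏa = ⁰a + t/1-t Σᵣ₌₁ᵏ a₀ʳ (1-t)ʳ (for every k, including k = 0), and dividing by
-- (1-t)ᵏ is the row formula. The column formula is the row formula for the transposed
-- array, which satisfies the same recurrence.

open import Defs
open import Level using (Level)
open import Function using (_∘_)
open import Data.Nat using (ℕ; zero; suc; _∸_; _≤_)
open import Data.Product using (_×_; _,_)
open import Algebra.Bundles using (CommutativeRing; CommutativeMonoid)
open import Relation.Binary.Bundles using (Setoid)
import Algebra.Properties.CommutativeSemigroup as CommutativeSemigroupProperties
import Algebra.Properties.Ring as RingProperties
import Algebra.Solver.CommutativeMonoid as CommutativeMonoidSolver
import Relation.Binary.Reasoning.Setoid as SetoidReasoning

module SeriesProperties {c ℓ : Level} (R : CommutativeRing c ℓ) where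
  open CommutativeRing R hiding (zero)
  open FPS R
  open RingProperties ring using (-0#≈0#)
  open CommutativeSemigroupProperties +-commutativeSemigroup using (interchange; x∙yz≈y∙xz)

  sumUpTo-cong : ∀ n {f g : ℕ → Carrier} → (∀ i → f i ≈ g i) → sumUpTo n f ≈ sumUpTo n g
  sumUpTo-cong zero    f≈g = f≈g zero
  sumUpTo-cong (suc n) f≈g = +-cong (sumUpTo-cong n f≈g) (f≈g (suc n))

  sumUpTo-+ : ∀ n (f g : ℕ → Carrier) → sumUpTo n (λ i → f i + g i) ≈ sumUpTo n f + sumUpTo n g
  sumUpTo-+ zero    f g = refl
  sumUpTo-+ (suc n) f g = trans (+-congʳ (sumUpTo-+ n f g)) (interchange _ _ _ _)

  sumUpTo-0# : ∀ n → sumUpTo n (λ _ → 0#) ≈ 0#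
  sumUpTo-0# zero    = refl
  sumUpTo-0# (suc n) = trans (+-identityʳ _) (sumUpTo-0# n)

  sumUpTo-suc : ∀ n (h : ℕ → Carrier) → sumUpTo (suc n) h ≈ h 0 + sumUpTo n (h ∘ suc)
  sumUpTo-suc zero    h = refl
  sumUpTo-suc (suc n) h = trans (+-congʳ (sumUpTo-suc n h)) (+-assoc _ _ _)

  ≈ₛ-setoid : Setoid c ℓ
  ≈ₛ-setoid = record
    { Carrier       = Series
    ; _≈_           = _≈ₛ_
    ; isEquivalence = record
      { refl  = λ _ → refl
      ; sym   = λ f≈g n → sym (f≈g n)
      ; trans = λ f≈g g≈h n → trans (f≈g n) (g≈h n)
      }
    }

  open Setoid ≈ₛ-setoid public using () renaming (refl to ≈ₛ-refl; sym to ≈ₛ-sym; trans to ≈ₛ-trans)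

  tail : Series → Series
  tail f = f ∘ suc

  zeroₛ≈0# : ∀ n → zeroₛ n ≈ 0#
  zeroₛ≈0# zero    = refl
  zeroₛ≈0# (suc n) = refl

  +ₛ-cong : ∀ {f f′ g g′} → f ≈ₛ f′ → g ≈ₛ g′ → f +ₛ g ≈ₛ f′ +ₛ g′
  +ₛ-cong f≈f′ g≈g′ n = +-cong (f≈f′ n) (g≈g′ n)

  +ₛ-congˡ : ∀ f {g g′} → g ≈ₛ g′ → f +ₛ g ≈ₛ f +ₛ g′
  +ₛ-congˡ f = +ₛ-cong (≈ₛ-refl {f})

  +ₛ-assoc : ∀ f g h → (f +ₛ g) +ₛ h ≈ₛ f +ₛ (g +ₛ h)
  +ₛ-assoc f g h n = +-assoc (f n) (g n) (h n)

  +ₛ-identityʳ : ∀ f → f +ₛ zeroₛ ≈ₛ f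
  +ₛ-identityʳ f n = trans (+-congˡ (zeroₛ≈0# n)) (+-identityʳ (f n))

  *ₛ-cong : ∀ {f f′ g g′} → f ≈ₛ f′ → g ≈ₛ g′ → f *ₛ g ≈ₛ f′ *ₛ g′
  *ₛ-cong f≈f′ g≈g′ n = sumUpTo-cong n (λ i → *-cong (f≈f′ i) (g≈g′ (n ∸ i)))

  *ₛ-congˡ : ∀ f {g g′} → g ≈ₛ g′ → f *ₛ g ≈ₛ f *ₛ g′
  *ₛ-congˡ f = *ₛ-cong (≈ₛ-refl {f})

  *ₛ-congʳ : ∀ h {f f′} → f ≈ₛ f′ → f *ₛ h ≈ₛ f′ *ₛ h
  *ₛ-congʳ h f≈f′ = *ₛ-cong f≈f′ (≈ₛ-refl {h})

  *ₛ-suc : ∀ f g n → (f *ₛ g) (suc n) ≈ f 0 * g (suc n) + (tail f *ₛ g) n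
  *ₛ-suc f g n = sumUpTo-suc n (λ i → f i * g (suc n ∸ i))

  const-*ₛ : ∀ x g n → (const x *ₛ g) n ≈ x * g n
  const-*ₛ x g zero    = refl
  const-*ₛ x g (suc n) = begin
    (const x *ₛ g) (suc n)                   ≈⟨ *ₛ-suc (const x) g n ⟩
    x * g (suc n) + (tail (const x) *ₛ g) n  ≈⟨ +-congˡ (trans (sumUpTo-cong n (λ _ → zeroˡ _)) (sumUpTo-0# n)) ⟩
    x * g (suc n) + 0#                       ≈⟨ +-identityʳ _ ⟩
    x * g (suc n)                            ∎
    where open SetoidReasoning setoid

  tail-*ₛ : ∀ f g → tail (f *ₛ g) ≈ₛ const (f 0) *ₛ tail g +ₛ tail f *ₛ g
  tail-*ₛ f g n = trans (*ₛ-suc f g n) (+-congʳ (sym (const-*ₛ (f 0) (tail g) n)))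

  *ₛ-distribʳ : ∀ f g h → (f +ₛ g) *ₛ h ≈ₛ f *ₛ h +ₛ g *ₛ h
  *ₛ-distribʳ f g h n = trans (sumUpTo-cong n (λ _ → distribʳ _ _ _)) (sumUpTo-+ n _ _)

  *ₛ-identityˡ : ∀ f → oneₛ *ₛ f ≈ₛ f
  *ₛ-identityˡ f n = trans (const-*ₛ 1# f n) (*-identityˡ (f n))

  *ₛ-assoc : ∀ f g h → (f *ₛ g) *ₛ h ≈ₛ f *ₛ (g *ₛ h)
  *ₛ-assoc f g h zero    = *-assoc (f 0) (g 0) (h 0)
  *ₛ-assoc f g h (suc n) = begin
    ((f *ₛ g) *ₛ h) (suc n)
      ≈⟨ *ₛ-suc (f *ₛ g) h n ⟩
    (f 0 * g 0) * h (suc n) + (tail (f *ₛ g) *ₛ h) n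
      ≈⟨ +-congˡ (trans (*ₛ-congʳ h (tail-*ₛ f g) n) (*ₛ-distribʳ _ _ h n)) ⟩
    (f 0 * g 0) * h (suc n) + (((const (f 0) *ₛ tail g) *ₛ h) n + ((tail f *ₛ g) *ₛ h) n)
      ≈⟨ +-congˡ (+-cong (trans (*ₛ-assoc (const (f 0)) (tail g) h n) (const-*ₛ (f 0) (tail g *ₛ h) n))
                         (*ₛ-assoc (tail f) g h n)) ⟩
    (f 0 * g 0) * h (suc n) + (f 0 * (tail g *ₛ h) n + (tail f *ₛ (g *ₛ h)) n)
      ≈⟨ sym (+-assoc _ _ _) ⟩
    ((f 0 * g 0) * h (suc n) + f 0 * (tail g *ₛ h) n) + (tail f *ₛ (g *ₛ h)) n
      ≈⟨ +-congʳ (trans (+-congʳ (*-assoc _ _ _)) (sym (distribˡ _ _ _))) ⟩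
    f 0 * (g 0 * h (suc n) + (tail g *ₛ h) n) + (tail f *ₛ (g *ₛ h)) n
      ≈⟨ +-congʳ (*-congˡ (sym (*ₛ-suc g h n))) ⟩
    f 0 * (g *ₛ h) (suc n) + (tail f *ₛ (g *ₛ h)) n
      ≈⟨ sym (*ₛ-suc f (g *ₛ h) n) ⟩
    (f *ₛ (g *ₛ h)) (suc n) ∎
    where open SetoidReasoning setoid

  -- Peeling the leading coefficient off both factors in turn reduces index n + 2 to index n.
  *ₛ-comm : ∀ f g → f *ₛ g ≈ₛ g *ₛ f
  *ₛ-comm f g zero             = *-comm (f 0) (g 0)
  *ₛ-comm f g (suc zero)       = begin
    (f *ₛ g) 1               ≈⟨ *ₛ-suc f g 0 ⟩
    f 0 * g 1 + f 1 * g 0    ≈⟨ +-comm _ _ ⟩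
    f 1 * g 0 + f 0 * g 1    ≈⟨ +-cong (*-comm _ _) (*-comm _ _) ⟩
    g 0 * f 1 + g 1 * f 0    ≈⟨ sym (*ₛ-suc g f 0) ⟩
    (g *ₛ f) 1               ∎
    where open SetoidReasoning setoid
  *ₛ-comm f g (suc (suc m)) = begin
    (f *ₛ g) (suc (suc m))
      ≈⟨ *ₛ-suc f g (suc m) ⟩
    f 0 * g (suc (suc m)) + (tail f *ₛ g) (suc m)
      ≈⟨ +-congˡ (trans (*ₛ-comm (tail f) g (suc m)) (*ₛ-suc g (tail f) m)) ⟩
    f 0 * g (suc (suc m)) + (g 0 * f (suc (suc m)) + (tail g *ₛ tail f) m)
      ≈⟨ +-congˡ (+-congˡ (*ₛ-comm (tail g) (tail f) m)) ⟩
    f 0 * g (suc (suc m)) + (g 0 * f (suc (suc m)) + (tail f *ₛ tail g) m)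
      ≈⟨ x∙yz≈y∙xz _ _ _ ⟩
    g 0 * f (suc (suc m)) + (f 0 * g (suc (suc m)) + (tail f *ₛ tail g) m)
      ≈⟨ +-congˡ (trans (sym (*ₛ-suc f (tail g) m)) (*ₛ-comm f (tail g) (suc m))) ⟩
    g 0 * f (suc (suc m)) + (tail g *ₛ f) (suc m)
      ≈⟨ sym (*ₛ-suc g f (suc m)) ⟩
    (g *ₛ f) (suc (suc m)) ∎
    where open SetoidReasoning setoid

  *ₛ-distribˡ : ∀ f g h → f *ₛ (g +ₛ h) ≈ₛ f *ₛ g +ₛ f *ₛ h
  *ₛ-distribˡ f g h n =
    trans (*ₛ-comm f _ n) (trans (*ₛ-distribʳ g h f n) (+-cong (*ₛ-comm g f n) (*ₛ-comm h f n)))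

  *ₛ-zeroʳ : ∀ f → f *ₛ zeroₛ ≈ₛ zeroₛ
  *ₛ-zeroʳ f n = trans (*ₛ-comm f zeroₛ n) (trans (const-*ₛ 0# f n) (trans (zeroˡ (f n)) (sym (zeroₛ≈0# n))))

  *ₛ-commutativeMonoid : CommutativeMonoid c ℓ
  *ₛ-commutativeMonoid = record
    { Carrier             = Series
    ; _≈_                 = _≈ₛ_
    ; _∙_                 = _*ₛ_
    ; ε                   = oneₛ
    ; isCommutativeMonoid = record
      { isMonoid = record
        { isSemigroup = record
          { isMagma = record { isEquivalence = Setoid.isEquivalence ≈ₛ-setoid ; ∙-cong = *ₛ-cong }
          ; assoc   = *ₛ-assoc
          }
        ; identity = *ₛ-identityˡ , λ f → ≈ₛ-trans (*ₛ-comm f oneₛ) (*ₛ-identityˡ f)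
        }
      ; comm = *ₛ-comm
      }
    }

  open CommutativeSemigroupProperties (CommutativeMonoid.commutativeSemigroup *ₛ-commutativeMonoid)
    using () renaming (interchange to *ₛ-interchange)
  open CommutativeMonoidSolver *ₛ-commutativeMonoid using (solve; _⊜_; _⊕_)

  ^ₛ-distrib-*ₛ : ∀ f g k → (f *ₛ g) ^ₛ k ≈ₛ (f ^ₛ k) *ₛ (g ^ₛ k)
  ^ₛ-distrib-*ₛ f g zero    = ≈ₛ-sym (*ₛ-identityˡ oneₛ)
  ^ₛ-distrib-*ₛ f g (suc k) =
    ≈ₛ-trans (*ₛ-congˡ (f *ₛ g) (^ₛ-distrib-*ₛ f g k)) (*ₛ-interchange f g (f ^ₛ k) (g ^ₛ k))

  ≈oneₛ⇒^ₛ≈oneₛ : ∀ {f} k → f ≈ₛ oneₛ → f ^ₛ k ≈ₛ oneₛ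
  ≈oneₛ⇒^ₛ≈oneₛ zero    f≈1 = ≈ₛ-refl
  ≈oneₛ⇒^ₛ≈oneₛ (suc k) f≈1 = ≈ₛ-trans (*ₛ-cong f≈1 (≈oneₛ⇒^ₛ≈oneₛ k f≈1)) (*ₛ-identityˡ oneₛ)

  oneMinusT-0 : oneMinusT 0 ≈ 1#
  oneMinusT-0 = trans (+-congˡ -0#≈0#) (+-identityʳ 1#)

  tail-oneMinusT : tail oneMinusT ≈ₛ const (- 1#)
  tail-oneMinusT zero    = +-identityˡ (- 1#)
  tail-oneMinusT (suc n) = -‿inverseʳ 0#

  oneMinusT-*ₛ-inv1-t : oneMinusT *ₛ inv1-t ≈ₛ oneₛ
  oneMinusT-*ₛ-inv1-t zero    = trans (*-identityʳ _) oneMinusT-0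
  oneMinusT-*ₛ-inv1-t (suc n) = begin
    (oneMinusT *ₛ inv1-t) (suc n)                        ≈⟨ *ₛ-suc oneMinusT inv1-t n ⟩
    oneMinusT 0 * 1# + (tail oneMinusT *ₛ inv1-t) n      ≈⟨ +-cong (trans (*-identityʳ _) oneMinusT-0) tail-term ⟩
    1# + - 1#                                            ≈⟨ -‿inverseʳ 1# ⟩
    0#                                                   ∎
    where
    open SetoidReasoning setoid
    tail-term : (tail oneMinusT *ₛ inv1-t) n ≈ - 1#
    tail-term = trans (*ₛ-congʳ inv1-t tail-oneMinusT n)
                      (trans (const-*ₛ (- 1#) inv1-t n) (*-identityʳ (- 1#)))

  inv1-t-*ₛ-oneMinusT : inv1-t *ₛ oneMinusT ≈ₛ oneₛ
  inv1-t-*ₛ-oneMinusT = ≈ₛ-trans (*ₛ-comm inv1-t oneMinusT) oneMinusT-*ₛ-inv1-t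

  oneMinusT-*ₛ-inv1-t-*ₛ : ∀ f → oneMinusT *ₛ (inv1-t *ₛ f) ≈ₛ f
  oneMinusT-*ₛ-inv1-t-*ₛ f =
    ≈ₛ-trans (≈ₛ-sym (*ₛ-assoc oneMinusT inv1-t f))
             (≈ₛ-trans (*ₛ-congʳ f oneMinusT-*ₛ-inv1-t) (*ₛ-identityˡ f))

  inv1-t^k-*ₛ-oneMinusT^k : ∀ k → (inv1-t ^ₛ k) *ₛ (oneMinusT ^ₛ k) ≈ₛ oneₛ
  inv1-t^k-*ₛ-oneMinusT^k k =
    ≈ₛ-trans (≈ₛ-sym (^ₛ-distrib-*ₛ inv1-t oneMinusT k)) (≈oneₛ⇒^ₛ≈oneₛ k inv1-t-*ₛ-oneMinusT)

  inv1-t-*ₛ-suc : ∀ f n → (inv1-t *ₛ f) (suc n) ≈ f (suc n) + (inv1-t *ₛ f) n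
  inv1-t-*ₛ-suc f n = trans (*ₛ-suc inv1-t f n) (+-congʳ (*-identityˡ _))

  tₛ-*ₛ-inv1-t-*ₛ-oneMinusT : ∀ f g → (tₛ *ₛ inv1-t) *ₛ (f *ₛ (oneMinusT *ₛ g)) ≈ₛ g *ₛ (f *ₛ tₛ)
  tₛ-*ₛ-inv1-t-*ₛ-oneMinusT f g = begin
    (tₛ *ₛ inv1-t) *ₛ (f *ₛ (oneMinusT *ₛ g))
      ≈⟨ solve 5 (λ t i f u g → (t ⊕ i) ⊕ (f ⊕ (u ⊕ g)) ⊜ (i ⊕ u) ⊕ (g ⊕ (f ⊕ t)))
               ≈ₛ-refl tₛ inv1-t f oneMinusT g ⟩
    (inv1-t *ₛ oneMinusT) *ₛ (g *ₛ (f *ₛ tₛ))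
      ≈⟨ ≈ₛ-trans (*ₛ-congʳ (g *ₛ (f *ₛ tₛ)) inv1-t-*ₛ-oneMinusT) (*ₛ-identityˡ _) ⟩
    g *ₛ (f *ₛ tₛ) ∎
    where open SetoidReasoning ≈ₛ-setoid

module Arrays {c ℓ : Level} (R : CommutativeRing c ℓ) where
  open CommutativeRing R hiding (zero)
  open FPS R
  open SeriesProperties R

  transpose : Array → Array
  transpose a n k = a k n

  colSeries≈rowSeries-transpose : ∀ a n → colSeries a n ≈ₛ rowSeries (transpose a) n
  colSeries≈rowSeries-transpose a n zero    = refl
  colSeries≈rowSeries-transpose a n (suc m) = refl

  IsPascal : Array → Set ℓ
  IsPascal a = ∀ n k → a (suc n) (suc k) ≈ a n (suc k) + a (suc n) k

  IsPascal-transpose : ∀ a → IsPascal a → IsPascal (transpose a)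
  IsPascal-transpose a pascal n k = trans (pascal k n) (+-comm _ _)

  module Rows (a : Array) (pascal : IsPascal a) where

    rowSeries-suc : ∀ k → rowSeries a (suc k) ≈ₛ inv1-t *ₛ (rowSeries a k +ₛ const (a 0 (suc k)) *ₛ tₛ)
    rowSeries-suc k zero    = sym (trans (*-identityˡ _) (trans (+-identityˡ _) (zeroʳ _)))
    rowSeries-suc k (suc n) = sym (partialSums n)
      where
      open SetoidReasoning setoid
      c₀ : Carrier
      c₀ = a 0 (suc k)
      X : Series
      X = rowSeries a k +ₛ const c₀ *ₛ tₛ
      partialSums : ∀ n → (inv1-t *ₛ X) (suc n) ≈ a (suc n) (suc k)
      partialSums zero = begin
        (inv1-t *ₛ X) 1                                    ≈⟨ inv1-t-*ₛ-suc X 0 ⟩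
        (a 1 k + (const c₀ *ₛ tₛ) 1) + 1# * (0# + c₀ * 0#)
          ≈⟨ +-cong (+-congˡ (trans (const-*ₛ c₀ tₛ 1) (*-identityʳ c₀)))
                    (trans (*-identityˡ _) (trans (+-identityˡ _) (zeroʳ c₀))) ⟩
        (a 1 k + c₀) + 0#                                  ≈⟨ trans (+-identityʳ _) (+-comm _ _) ⟩
        c₀ + a 1 k                                         ≈⟨ sym (pascal 0 k) ⟩
        a 1 (suc k)                                        ∎
      partialSums (suc n) = begin
        (inv1-t *ₛ X) (suc (suc n))                        ≈⟨ inv1-t-*ₛ-suc X (suc n) ⟩
        (a (suc (suc n)) k + (const c₀ *ₛ tₛ) (suc (suc n))) + (inv1-t *ₛ X) (suc n)
          ≈⟨ +-cong (trans (+-congˡ (trans (const-*ₛ c₀ tₛ (suc (suc n))) (zeroʳ c₀))) (+-identityʳ _))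
                    (partialSums n) ⟩
        a (suc (suc n)) k + a (suc n) (suc k)              ≈⟨ +-comm _ _ ⟩
        a (suc n) (suc k) + a (suc (suc n)) k              ≈⟨ sym (pascal (suc n) k) ⟩
        a (suc (suc n)) (suc k)                            ∎

    numerator : ℕ → Series
    numerator k = rowSeries a 0 +ₛ (tₛ *ₛ inv1-t) *ₛ sumFrom1 k (λ r → const (a 0 r) *ₛ (oneMinusT ^ₛ r))

    oneMinusT^k-*ₛ-rowSeries : ∀ k → (oneMinusT ^ₛ k) *ₛ rowSeries a k ≈ₛ numerator k
    oneMinusT^k-*ₛ-rowSeries zero = ≈ₛ-trans (*ₛ-identityˡ (rowSeries a 0))
      (≈ₛ-sym (≈ₛ-trans (+ₛ-congˡ (rowSeries a 0) (*ₛ-zeroʳ (tₛ *ₛ inv1-t))) (+ₛ-identityʳ (rowSeries a 0))))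
    oneMinusT^k-*ₛ-rowSeries (suc k) = begin
      (oneMinusT *ₛ Uᵏ) *ₛ rowSeries a (suc k)
        ≈⟨ solve 3 (λ u v r → (u ⊕ v) ⊕ r ⊜ v ⊕ (u ⊕ r)) ≈ₛ-refl oneMinusT Uᵏ (rowSeries a (suc k)) ⟩
      Uᵏ *ₛ (oneMinusT *ₛ rowSeries a (suc k))
        ≈⟨ *ₛ-congˡ Uᵏ (≈ₛ-trans (*ₛ-congˡ oneMinusT (rowSeries-suc k))
                                 (oneMinusT-*ₛ-inv1-t-*ₛ (rowSeries a k +ₛ c₀ *ₛ tₛ))) ⟩
      Uᵏ *ₛ (rowSeries a k +ₛ c₀ *ₛ tₛ)
        ≈⟨ *ₛ-distribˡ Uᵏ (rowSeries a k) (c₀ *ₛ tₛ) ⟩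
      Uᵏ *ₛ rowSeries a k +ₛ Uᵏ *ₛ (c₀ *ₛ tₛ)
        ≈⟨ +ₛ-cong (oneMinusT^k-*ₛ-rowSeries k) (≈ₛ-sym (tₛ-*ₛ-inv1-t-*ₛ-oneMinusT c₀ Uᵏ)) ⟩
      numerator k +ₛ t/1-t *ₛ (c₀ *ₛ (oneMinusT *ₛ Uᵏ))
        ≈⟨ +ₛ-assoc (rowSeries a 0) (t/1-t *ₛ Σᵏ) _ ⟩
      rowSeries a 0 +ₛ (t/1-t *ₛ Σᵏ +ₛ t/1-t *ₛ (c₀ *ₛ (oneMinusT *ₛ Uᵏ)))
        ≈⟨ +ₛ-congˡ (rowSeries a 0) (≈ₛ-sym (*ₛ-distribˡ t/1-t Σᵏ (c₀ *ₛ (oneMinusT *ₛ Uᵏ)))) ⟩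
      numerator (suc k) ∎
      where
      open SetoidReasoning ≈ₛ-setoid
      open CommutativeMonoidSolver *ₛ-commutativeMonoid using (solve; _⊜_; _⊕_)
      Uᵏ c₀ t/1-t Σᵏ : Series
      Uᵏ = oneMinusT ^ₛ k
      c₀ = const (a 0 (suc k))
      t/1-t = tₛ *ₛ inv1-t
      Σᵏ = sumFrom1 k (λ r → const (a 0 r) *ₛ (oneMinusT ^ₛ r))

    rowSeries-closedForm : ∀ k → rowSeries a k ≈ₛ (inv1-t ^ₛ k) *ₛ numerator k
    rowSeries-closedForm k = begin
      rowSeries a k                                              ≈⟨ *ₛ-identityˡ (rowSeries a k) ⟨
      oneₛ *ₛ rowSeries a k                                      ≈⟨ *ₛ-congʳ (rowSeries a k) (inv1-t^k-*ₛ-oneMinusT^k k) ⟨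
      ((inv1-t ^ₛ k) *ₛ (oneMinusT ^ₛ k)) *ₛ rowSeries a k       ≈⟨ *ₛ-assoc (inv1-t ^ₛ k) (oneMinusT ^ₛ k) (rowSeries a k) ⟩
      (inv1-t ^ₛ k) *ₛ ((oneMinusT ^ₛ k) *ₛ rowSeries a k)       ≈⟨ *ₛ-congˡ (inv1-t ^ₛ k) (oneMinusT^k-*ₛ-rowSeries k) ⟩
      (inv1-t ^ₛ k) *ₛ numerator k                               ∎
      where open SetoidReasoning ≈ₛ-setoid

  colSeries-closedForm : ∀ a → IsPascal a → ∀ n →
    colSeries a n ≈ₛ (inv1-t ^ₛ n) *ₛ (colSeries a 0 +ₛ (tₛ *ₛ inv1-t) *ₛ sumFrom1 n (λ j → const (a j 0) *ₛ (oneMinusT ^ₛ j)))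
  colSeries-closedForm a pascal n = begin
    colSeries a n
      ≈⟨ colSeries≈rowSeries-transpose a n ⟩
    rowSeries (transpose a) n
      ≈⟨ Rows.rowSeries-closedForm (transpose a) (IsPascal-transpose a pascal) n ⟩
    (inv1-t ^ₛ n) *ₛ (rowSeries (transpose a) 0 +ₛ boundaryTerm)
      ≈⟨ *ₛ-congˡ (inv1-t ^ₛ n) (+ₛ-cong (≈ₛ-sym (colSeries≈rowSeries-transpose a 0)) (≈ₛ-refl {boundaryTerm})) ⟩
    (inv1-t ^ₛ n) *ₛ (colSeries a 0 +ₛ boundaryTerm) ∎
    where
    open SetoidReasoning ≈ₛ-setoid
    boundaryTerm : Series
    boundaryTerm = (tₛ *ₛ inv1-t) *ₛ sumFrom1 n (λ j → const (a j 0) *ₛ (oneMinusT ^ₛ j))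

theorem3 : ∀ {c ℓ} (R : CommutativeRing c ℓ) →
    let open CommutativeRing R in let open FPS R in
    (a : Array) →
    (∀ n k → a (suc n) (suc k) ≈ a n (suc k) + a (suc n) k) →
    (∀ k → 1 ≤ k →
      rowSeries a k ≈ₛ (inv1-t ^ₛ k) *ₛ (rowSeries a 0 +ₛ (tₛ *ₛ inv1-t) *ₛ sumFrom1 k (λ r → const (a 0 r) *ₛ (oneMinusT ^ₛ r))))
    ×
    (∀ n → 1 ≤ n →
      colSeries a n ≈ₛ (inv1-t ^ₛ n) *ₛ (colSeries a 0 +ₛ (tₛ *ₛ inv1-t) *ₛ sumFrom1 n (λ j → const (a j 0) *ₛ (oneMinusT ^ₛ j))))
theorem3 R a pascal =
  (λ k _ → Rows.rowSeries-closedForm a pascal k) , (λ n _ → colSeries-closedForm a pascal n)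
  where open Arrays R
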